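{- Let $G$ be a connected graph with at least $2$ vertices and $H$ a connected graph. Then \[F(G+_S H)=|V(H)|F(G)+|V(G)|F(H)+6|E(H)|M_1(G)+6|E(G)|M_1(H)+8|V(H)||E(G)|.\]
   Context: All graphs are finite, simple and undirected; $d_G(v)$ denotes degree. $F(G)=\sum_{v\in V(G)}d_G(v)^3$ and $M_1(G)=\sum_{v\in V(G)}d_G(v)^2$. The subdivision graph $S(G)$ is obtained from $G$ by replacing each edge by a path of length two; its vertex set is $V(G)\cup E(G)$. For an operation $\Phi\in\{S,R,Q,T\}$, the $\Phi$-sum $G+_\Phi H$ is the graph with vertex set $(V(G)\cup E(G))\times V(H)$ in which $(u,v)$ and $(u',v')$ are adjacent if and only if [$u=u'\in V(G)$ and $vv'\in E(H)$] or [$v=v'$ and $uu'\in E(\Phi(G))$]. -}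

module Defs where

open import Data.Nat using (ℕ; zero; suc; _+_; _*_; _^_; _<ᵇ_)
open import Data.Bool using (Bool; true; false; _∧_; _∨_; if_then_else_)
open import Data.Fin using (Fin; toℕ; splitAt; remQuot)
open import Data.Fin.Properties using (_≟_)
open import Data.Sum using (_⊎_; inj₁; inj₂)
open import Data.Product using (_×_; _,_; proj₁; proj₂)
open import Data.Nat.ListAction using (sum)
open import Data.List using (List; map; allFin; concatMap; filterᵇ; length; lookup)
open import Relation.Nullary.Decidable using (⌊_⌋)
open import Relation.Binary.PropositionalEquality using (_≡_)

RawGraph : ℕ → Set
RawGraph n = Fin n → Fin n → Bool

record Graph (n : ℕ) : Set where
  field
    adj    : RawGraph n
    sym    : ∀ i j → adj i j ≡ adj j i
    irrefl : ∀ i → adj i i ≡ false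
open Graph public

b2n : Bool → ℕ
b2n true  = 1
b2n false = 0

deg : ∀ {n} → RawGraph n → Fin n → ℕ
deg {n} a i = sum (map (λ j → b2n (a i j)) (allFin n))

Fidx : ∀ {n} → RawGraph n → ℕ
Fidx {n} a = sum (map (λ i → deg a i ^ 3) (allFin n))

M1 : ∀ {n} → RawGraph n → ℕ
M1 {n} a = sum (map (λ i → deg a i ^ 2) (allFin n))

edgeList : ∀ {n} → RawGraph n → List (Fin n × Fin n)
edgeList {n} a =
  filterᵇ (λ p → a (proj₁ p) (proj₂ p) ∧ (toℕ (proj₁ p) <ᵇ toℕ (proj₂ p)))
          (concatMap (λ i → map (i ,_) (allFin n)) (allFin n))

size : ∀ {n} → RawGraph n → ℕ
size a = length (edgeList a)

Edge : ∀ {n} → Graph n → Set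
Edge G = Fin (size (adj G))

endpoints : ∀ {n} (G : Graph n) → Edge G → Fin n × Fin n
endpoints G k = lookup (edgeList (adj G)) k

incident : ∀ {n} (G : Graph n) → Fin n → Edge G → Bool
incident G u k = ⌊ u ≟ proj₁ (endpoints G k) ⌋ ∨ ⌊ u ≟ proj₂ (endpoints G k) ⌋

-- Vertex set of S(G) is V(G) ∪ E(G), encoded as Fin (n + |E(G)|)
-- via splitAt (first n are the original vertices, the rest the edges).
subdivAdj' : ∀ {n} (G : Graph n) → Fin n ⊎ Edge G → Fin n ⊎ Edge G → Bool
subdivAdj' G (inj₁ u) (inj₂ k) = incident G u k
subdivAdj' G (inj₂ k) (inj₁ u) = incident G u k
subdivAdj' G _ _ = false

subdivAdj : ∀ {n} (G : Graph n) → RawGraph (n + size (adj G))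
subdivAdj {n} G x y = subdivAdj' G (splitAt n x) (splitAt n y)

isVertex : ∀ {n} (G : Graph n) → Fin (n + size (adj G)) → Bool
isVertex {n} G x with splitAt n x
... | inj₁ _ = true
... | inj₂ _ = false

-- The S-sum G +_S H on (V(G) ∪ E(G)) × V(H), encoded as
-- Fin ((n + |E(G)|) * m) via remQuot.
-- (u,v) ~ (u',v')  iff  [u = u' ∈ V(G) and vv' ∈ E(H)] or [v = v' and uu' ∈ E(S(G))]
SSumAdj' : ∀ {n m} (G : Graph n) (H : Graph m) →
           Fin (n + size (adj G)) × Fin m → Fin (n + size (adj G)) × Fin m → Bool
SSumAdj' G H (u , v) (u' , v') =
  (isVertex G u ∧ ⌊ u ≟ u' ⌋ ∧ adj H v v') ∨ (⌊ v ≟ v' ⌋ ∧ subdivAdj G u u')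

SSum : ∀ {n m} (G : Graph n) (H : Graph m) → RawGraph ((n + size (adj G)) * m)
SSum {n} {m} G H x y = SSumAdj' G H (remQuot m x) (remQuot m y)

data Reachable {n} (G : Graph n) : Fin n → Fin n → Set where
  here : ∀ {i} → Reachable G i i
  step : ∀ {i j k} → adj G i j ≡ true → Reachable G j k → Reachable G i k

Connected : ∀ {n} → Graph n → Set
Connected {n} G = ∀ (i j : Fin n) → Reachable G i j

-- A vertex (u, v) of G +_S H with u ∈ V(G) is adjacent to the d_H(v) vertices (u, v') of its
-- H-fibre and to the d_G(u) edge-vertices (e, v) of its S(G)-layer, so it has degree
-- d_G(u) + d_H(v); a vertex (e, v) with e ∈ E(G) only sees the two ends of e, so it has degree 2.
-- Summing cubes, the binomial expansion of (d_G(u) + d_H(v))³ over V(G) × V(H) together with the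
-- handshake lemma Σ d = 2|E| gives every term except 8|V(H)||E(G)|, which comes from the edge
-- vertices.
module Submission where

open import Algebra.Properties.CommutativeSemigroup using (x∙yz≈y∙xz)
open import Data.Bool using (Bool; true; false; _∧_; _∨_)
open import Data.Bool.Properties using (∧-zeroʳ)
open import Data.Fin using (Fin; zero; suc; toℕ; splitAt; remQuot; combine; _↑ˡ_; _↑ʳ_)
open import Data.Fin.Properties using (_≟_; toℕ-injective; splitAt-↑ˡ; splitAt-↑ʳ; remQuot-combine)
open import Data.List using (List; []; _∷_; map; allFin; tabulate; concatMap; filterᵇ; length; lookup)
open import Data.List.Properties using (map-tabulate; map-++; map-∘)
open import Data.Nat using (ℕ; zero; suc; _+_; _*_; _^_; _<ᵇ_; _≤_)
open import Data.Nat.ListAction using () renaming (sum to listSum)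
open import Data.Nat.ListAction.Properties using (sum-++)
open import Data.Nat.Properties
  using (+-*-semiring; *-commutativeSemigroup; +-identityʳ; +-assoc; +-comm;
         *-identityˡ; *-identityʳ; *-zeroʳ; *-distribˡ-+)
open import Data.Nat.Tactic.RingSolver using (solve-∀)
open import Data.Product using (_×_; _,_; proj₁; proj₂; uncurry)
open import Data.Sum using (_⊎_; inj₁; inj₂)
open import Function using (_∘_; id; case_of_)
open import Relation.Binary.PropositionalEquality
open import Relation.Nullary.Decidable using (⌊_⌋; yes; no; dec-false; isYes≗does; ⌊⌋-map′)
open import Relation.Nullary.Negation using (contradiction)

open import Algebra.Properties.Semiring.Sum +-*-semiring
  using (sum-syntax; sum-cong-≗; sum-replicate-zero; ∑-distrib-+; ∑-comm; *-distribˡ-sum; *-distribʳ-sum)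
open import Defs hiding (sym)
open ≡-Reasoning

∑-const : ∀ n c → ∑[ _ < n ] c ≡ n * c
∑-const zero    c = refl
∑-const (suc n) c = cong (c +_) (∑-const n c)

∑∑-distrib-+ : ∀ {n m} (f g : Fin n → Fin m → ℕ) →
  ∑[ i < n ] ∑[ j < m ] (f i j + g i j) ≡ ∑[ i < n ] ∑[ j < m ] f i j + ∑[ i < n ] ∑[ j < m ] g i j
∑∑-distrib-+ {m = m} f g = trans (sum-cong-≗ (λ i → ∑-distrib-+ (f i) (g i)))
  (∑-distrib-+ (λ i → ∑[ j < m ] f i j) (λ i → ∑[ j < m ] g i j))

∑∑-* : ∀ {n m} (f : Fin n → ℕ) (g : Fin m → ℕ) →
  ∑[ i < n ] ∑[ j < m ] (f i * g j) ≡ ∑[ i < n ] f i * ∑[ j < m ] g j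
∑∑-* f g = trans (sum-cong-≗ (λ i → sym (*-distribˡ-sum (f i) g))) (sym (*-distribʳ-sum _ f))

∑-↑ : ∀ n {s} (f : Fin (n + s) → ℕ) →
  ∑[ x < n + s ] f x ≡ ∑[ i < n ] f (i ↑ˡ s) + ∑[ k < s ] f (n ↑ʳ k)
∑-↑ zero    f = refl
∑-↑ (suc n) f = trans (cong (f zero +_) (∑-↑ n (f ∘ suc))) (sym (+-assoc (f zero) _ _))

∑-splitAt : ∀ n {s} (g : Fin n ⊎ Fin s → ℕ) →
  ∑[ x < n + s ] g (splitAt n x) ≡ ∑[ i < n ] g (inj₁ i) + ∑[ k < s ] g (inj₂ k)
∑-splitAt n {s} g = trans (∑-↑ n _)
  (cong₂ _+_ (sum-cong-≗ (λ i → cong g (splitAt-↑ˡ n i s)))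
             (sum-cong-≗ (λ k → cong g (splitAt-↑ʳ n s k))))

∑-combine : ∀ k {m} (f : Fin (k * m) → ℕ) →
  ∑[ x < k * m ] f x ≡ ∑[ i < k ] ∑[ j < m ] f (combine i j)
∑-combine zero        f = refl
∑-combine (suc k) {m} f =
  trans (∑-↑ m f) (cong (∑[ j < m ] f (j ↑ˡ k * m) +_) (∑-combine k (f ∘ (m ↑ʳ_))))

∑-remQuot : ∀ k m (g : Fin k × Fin m → ℕ) →
  ∑[ x < k * m ] g (remQuot m x) ≡ ∑[ i < k ] ∑[ j < m ] g (i , j)
∑-remQuot k m g =
  trans (∑-combine k _) (sum-cong-≗ (λ i → sum-cong-≗ (λ j → cong g (remQuot-combine i j))))

⌊suc≟suc⌋ : ∀ {n} (i j : Fin n) → ⌊ suc i ≟ suc j ⌋ ≡ ⌊ i ≟ j ⌋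
⌊suc≟suc⌋ i j = ⌊⌋-map′ _ _ (i ≟ j)

∑-δ : ∀ {n} (i : Fin n) (f : Fin n → ℕ) → ∑[ j < n ] (b2n ⌊ i ≟ j ⌋ * f j) ≡ f i
∑-δ {suc n} zero    f = trans (cong₂ _+_ (+-identityʳ (f zero)) (sum-replicate-zero n)) (+-identityʳ (f zero))
∑-δ {suc n} (suc i) f =
  trans (sum-cong-≗ (λ j → cong (λ b → b2n b * f (suc j)) (⌊suc≟suc⌋ i j))) (∑-δ i (f ∘ suc))

⌊≟⌋-comm : ∀ {n} (i j : Fin n) → ⌊ i ≟ j ⌋ ≡ ⌊ j ≟ i ⌋
⌊≟⌋-comm i j with i ≟ j | j ≟ i
... | yes _   | yes _   = refl
... | no  _   | no  _   = refl
... | yes i≡j | no  j≢i = contradiction (sym i≡j) j≢i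
... | no  i≢j | yes j≡i = contradiction (sym j≡i) i≢j

∑-δ≡1 : ∀ {n} (i : Fin n) → ∑[ j < n ] b2n ⌊ j ≟ i ⌋ ≡ 1
∑-δ≡1 i =
  trans (sum-cong-≗ (λ j → trans (cong b2n (⌊≟⌋-comm j i)) (sym (*-identityʳ _)))) (∑-δ i (λ _ → 1))

b2n-∧ : ∀ x y → b2n (x ∧ y) ≡ b2n x * b2n y
b2n-∧ true  y = sym (+-identityʳ (b2n y))
b2n-∧ false y = refl

b2n-∨-disjoint : ∀ x y → x ∧ y ≡ false → b2n (x ∨ y) ≡ b2n x + b2n y
b2n-∨-disjoint true  true  ()
b2n-∨-disjoint true  false _ = refl
b2n-∨-disjoint false y     _ = refl

δ-disjoint : ∀ {n} (u : Fin n) {i j} → i ≢ j → ⌊ u ≟ i ⌋ ∧ ⌊ u ≟ j ⌋ ≡ false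
δ-disjoint u {i} {j} i≢j with u ≟ i
... | yes refl = trans (isYes≗does (u ≟ j)) (dec-false (u ≟ j) i≢j)
... | no  _    = refl

<ᵇ-exactly-one : ∀ {m n} → m ≢ n → b2n (m <ᵇ n) + b2n (n <ᵇ m) ≡ 1
<ᵇ-exactly-one {zero}  {zero}  m≢n = case m≢n refl of λ ()
<ᵇ-exactly-one {zero}  {suc n} _   = refl
<ᵇ-exactly-one {suc m} {zero}  _   = refl
<ᵇ-exactly-one {suc m} {suc n} m≢n = <ᵇ-exactly-one (m≢n ∘ cong suc)

listSum-tabulate : ∀ {n} (f : Fin n → ℕ) → listSum (tabulate f) ≡ ∑[ i < n ] f i
listSum-tabulate {zero}  f = refl
listSum-tabulate {suc n} f = cong (f zero +_) (listSum-tabulate (f ∘ suc))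

listSum-allFin : ∀ {n} (f : Fin n → ℕ) → listSum (map f (allFin n)) ≡ ∑[ i < n ] f i
listSum-allFin f = trans (cong listSum (map-tabulate id f)) (listSum-tabulate f)

listSum-lookup : ∀ {A : Set} (xs : List A) (h : A → ℕ) →
  ∑[ k < length xs ] h (lookup xs k) ≡ listSum (map h xs)
listSum-lookup []       h = refl
listSum-lookup (x ∷ xs) h = cong (h x +_) (listSum-lookup xs h)

listSum-concatMap : ∀ {A B : Set} (f : A → List B) (g : B → ℕ) xs →
  listSum (map g (concatMap f xs)) ≡ listSum (map (λ x → listSum (map g (f x))) xs)
listSum-concatMap f g []       = refl
listSum-concatMap f g (x ∷ xs) =
  trans (cong listSum (map-++ g (f x) _))
        (trans (sum-++ (map g (f x)) _) (cong (_ +_) (listSum-concatMap f g xs)))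

listSum-filterᵇ : ∀ {A : Set} (p : A → Bool) (h : A → ℕ) xs →
  listSum (map h (filterᵇ p xs)) ≡ listSum (map (λ x → b2n (p x) * h x) xs)
listSum-filterᵇ p h []       = refl
listSum-filterᵇ p h (x ∷ xs) with p x
... | true  = cong₂ _+_ (sym (+-identityʳ (h x))) (listSum-filterᵇ p h xs)
... | false = listSum-filterᵇ p h xs

lookup-filterᵇ : ∀ {A : Set} (p : A → Bool) xs k → p (lookup (filterᵇ p xs) k) ≡ true
lookup-filterᵇ p (x ∷ xs) k with p x in px
lookup-filterᵇ p (x ∷ xs) zero    | true  = px
lookup-filterᵇ p (x ∷ xs) (suc k) | true  = lookup-filterᵇ p xs k
... | false = lookup-filterᵇ p xs k

orientedEdge : ∀ {n} → RawGraph n → Fin n → Fin n → Bool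
orientedEdge a i j = a i j ∧ (toℕ i <ᵇ toℕ j)

allPairs : ∀ n → List (Fin n × Fin n)
allPairs n = concatMap (λ i → map (i ,_) (allFin n)) (allFin n)

listSum-edgeList : ∀ {n} (a : RawGraph n) (h : Fin n × Fin n → ℕ) →
  listSum (map h (edgeList a)) ≡ ∑[ i < n ] ∑[ j < n ] (b2n (orientedEdge a i j) * h (i , j))
listSum-edgeList {n} a h = begin
  listSum (map h (edgeList a))
    ≡⟨ listSum-filterᵇ (uncurry (orientedEdge a)) h (allPairs n) ⟩
  listSum (map w (allPairs n))
    ≡⟨ listSum-concatMap (λ i → map (i ,_) (allFin n)) w (allFin n) ⟩
  listSum (map (λ i → listSum (map w (map (i ,_) (allFin n)))) (allFin n))
    ≡⟨ listSum-allFin (λ i → listSum (map w (map (i ,_) (allFin n)))) ⟩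
  ∑[ i < n ] listSum (map w (map (i ,_) (allFin n)))
    ≡⟨ sum-cong-≗ (λ i → trans (cong listSum (sym (map-∘ (allFin n))))
                               (listSum-allFin (λ j → w (i , j)))) ⟩
  ∑[ i < n ] ∑[ j < n ] w (i , j) ∎
  where
  w : Fin n × Fin n → ℕ
  w p = b2n (uncurry (orientedEdge a) p) * h p

orientedEdge⇒≢ : ∀ {n} (G : Graph n) {i j} → orientedEdge (adj G) i j ≡ true → i ≢ j
orientedEdge⇒≢ G {i} e refl = case trans (sym e) (cong (_∧ _) (Graph.irrefl G i)) of λ ()

endpoints-orientedEdge : ∀ {n} (G : Graph n) (k : Edge G) →
  orientedEdge (adj G) (proj₁ (endpoints G k)) (proj₂ (endpoints G k)) ≡ true
endpoints-orientedEdge {n} G k =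
  lookup-filterᵇ (uncurry (orientedEdge (adj G))) (allPairs n) k

b2n-orientedEdge-+ : ∀ {n} (G : Graph n) (u j : Fin n) →
  b2n (orientedEdge (adj G) u j) + b2n (orientedEdge (adj G) j u) ≡ b2n (adj G u j)
b2n-orientedEdge-+ G u j rewrite Graph.sym G j u with u ≟ j
... | yes refl rewrite Graph.irrefl G u = refl
... | no  u≢j  = begin
  b2n (c ∧ (toℕ u <ᵇ toℕ j)) + b2n (c ∧ (toℕ j <ᵇ toℕ u))
    ≡⟨ cong₂ _+_ (b2n-∧ c _) (b2n-∧ c _) ⟩
  b2n c * b2n (toℕ u <ᵇ toℕ j) + b2n c * b2n (toℕ j <ᵇ toℕ u)
    ≡⟨ sym (*-distribˡ-+ (b2n c) _ _) ⟩
  b2n c * (b2n (toℕ u <ᵇ toℕ j) + b2n (toℕ j <ᵇ toℕ u))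
    ≡⟨ cong (b2n c *_) (<ᵇ-exactly-one (u≢j ∘ toℕ-injective)) ⟩
  b2n c * 1
    ≡⟨ *-identityʳ (b2n c) ⟩
  b2n c ∎
  where c = adj G u j

∑-incident≡deg : ∀ {n} (G : Graph n) (u : Fin n) →
  ∑[ k < size (adj G) ] b2n (incident G u k) ≡ deg (adj G) u
∑-incident≡deg {n} G u = begin
  ∑[ k < size a ] h (lookup (edgeList a) k)
    ≡⟨ listSum-lookup (edgeList a) h ⟩
  listSum (map h (edgeList a))
    ≡⟨ listSum-edgeList a h ⟩
  ∑[ i < n ] ∑[ j < n ] (e i j * h (i , j))
    ≡⟨ sum-cong-≗ (λ i → sum-cong-≗ (λ j → split i j (orientedEdge⇒≢ G))) ⟩
  ∑[ i < n ] ∑[ j < n ] (δ i * e i j + δ j * e i j)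
    ≡⟨ ∑∑-distrib-+ (λ i j → δ i * e i j) (λ i j → δ j * e i j) ⟩
  ∑[ i < n ] ∑[ j < n ] (δ i * e i j) + ∑[ i < n ] ∑[ j < n ] (δ j * e i j)
    ≡⟨ cong₂ _+_ (trans (∑-comm (λ i j → δ i * e i j)) (sum-cong-≗ (λ j → ∑-δ u (λ i → e i j))))
                 (sum-cong-≗ (λ i → ∑-δ u (e i))) ⟩
  ∑[ j < n ] e u j + ∑[ i < n ] e i u
    ≡⟨ sym (∑-distrib-+ (e u) (λ j → e j u)) ⟩
  ∑[ j < n ] (e u j + e j u)
    ≡⟨ sum-cong-≗ (b2n-orientedEdge-+ G u) ⟩
  ∑[ j < n ] b2n (a u j)
    ≡⟨ sym (listSum-allFin (λ j → b2n (a u j))) ⟩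
  deg a u ∎
  where
  a = adj G
  e : Fin n → Fin n → ℕ
  e i j = b2n (orientedEdge a i j)
  δ : Fin n → ℕ
  δ i = b2n ⌊ u ≟ i ⌋
  h : Fin n × Fin n → ℕ
  h p = b2n (⌊ u ≟ proj₁ p ⌋ ∨ ⌊ u ≟ proj₂ p ⌋)
  split : ∀ i j → (orientedEdge a i j ≡ true → i ≢ j) → e i j * h (i , j) ≡ δ i * e i j + δ j * e i j
  split i j i≢j with orientedEdge a i j
  ... | false = sym (cong₂ _+_ (*-zeroʳ (δ i)) (*-zeroʳ (δ j)))
  ... | true  = begin
    h (i , j) + 0             ≡⟨ +-identityʳ _ ⟩
    h (i , j)                 ≡⟨ b2n-∨-disjoint ⌊ u ≟ i ⌋ ⌊ u ≟ j ⌋ (δ-disjoint u (i≢j refl)) ⟩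
    δ i + δ j                 ≡⟨ sym (cong₂ _+_ (*-identityʳ (δ i)) (*-identityʳ (δ j))) ⟩
    δ i * 1 + δ j * 1         ∎

∑-incident≡2 : ∀ {n} (G : Graph n) (k : Edge G) → ∑[ w < n ] b2n (incident G w k) ≡ 2
∑-incident≡2 {n} G k = begin
  ∑[ w < n ] b2n (⌊ w ≟ i ⌋ ∨ ⌊ w ≟ j ⌋)
    ≡⟨ sum-cong-≗ (λ w → b2n-∨-disjoint ⌊ w ≟ i ⌋ ⌊ w ≟ j ⌋ (δ-disjoint w i≢j)) ⟩
  ∑[ w < n ] (b2n ⌊ w ≟ i ⌋ + b2n ⌊ w ≟ j ⌋)
    ≡⟨ ∑-distrib-+ (λ w → b2n ⌊ w ≟ i ⌋) (λ w → b2n ⌊ w ≟ j ⌋) ⟩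
  ∑[ w < n ] b2n ⌊ w ≟ i ⌋ + ∑[ w < n ] b2n ⌊ w ≟ j ⌋
    ≡⟨ cong₂ _+_ (∑-δ≡1 i) (∑-δ≡1 j) ⟩
  2 ∎
  where
  i = proj₁ (endpoints G k)
  j = proj₂ (endpoints G k)
  i≢j = orientedEdge⇒≢ G (endpoints-orientedEdge G k)

handshake : ∀ {n} (G : Graph n) → ∑[ u < n ] deg (adj G) u ≡ size (adj G) * 2
handshake {n} G = begin
  ∑[ u < n ] deg (adj G) u
    ≡⟨ sum-cong-≗ (λ u → sym (∑-incident≡deg G u)) ⟩
  ∑[ u < n ] ∑[ k < s ] b2n (incident G u k)
    ≡⟨ ∑-comm (λ u k → b2n (incident G u k)) ⟩
  ∑[ k < s ] ∑[ u < n ] b2n (incident G u k)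
    ≡⟨ sum-cong-≗ (∑-incident≡2 G) ⟩
  ∑[ k < s ] 2
    ≡⟨ ∑-const s 2 ⟩
  s * 2 ∎
  where s = size (adj G)

subdivAdj-irrefl : ∀ {n} (G : Graph n) x → subdivAdj G x x ≡ false
subdivAdj-irrefl {n} G x with splitAt n x
... | inj₁ _ = refl
... | inj₂ _ = refl

deg-subdivAdj : ∀ {n} (G : Graph n) (x : Fin (n + size (adj G))) →
  deg (subdivAdj G) x ≡ ∑[ w < n ] b2n (subdivAdj' G (splitAt n x) (inj₁ w))
                        + ∑[ k < size (adj G) ] b2n (subdivAdj' G (splitAt n x) (inj₂ k))
deg-subdivAdj {n} G x =
  trans (listSum-allFin (λ y → b2n (subdivAdj G x y))) (∑-splitAt n (b2n ∘ subdivAdj' G (splitAt n x)))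

deg-subdivAdj-vertex : ∀ {n} (G : Graph n) (u : Fin n) →
  deg (subdivAdj G) (u ↑ˡ size (adj G)) ≡ deg (adj G) u
deg-subdivAdj-vertex {n} G u
  rewrite deg-subdivAdj G (u ↑ˡ size (adj G)) | splitAt-↑ˡ n u (size (adj G))
  = trans (cong (_+ ∑[ k < size (adj G) ] b2n (incident G u k)) (sum-replicate-zero n)) (∑-incident≡deg G u)

deg-subdivAdj-edge : ∀ {n} (G : Graph n) (k : Edge G) → deg (subdivAdj G) (n ↑ʳ k) ≡ 2
deg-subdivAdj-edge {n} G k
  rewrite deg-subdivAdj G (n ↑ʳ k) | splitAt-↑ʳ n (size (adj G)) k
  = trans (cong (∑[ w < n ] b2n (incident G w k) +_) (sum-replicate-zero (size (adj G))))
          (trans (+-identityʳ _) (∑-incident≡2 G k))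

isVertex-↑ˡ : ∀ {n} (G : Graph n) (u : Fin n) → isVertex G (u ↑ˡ size (adj G)) ≡ true
isVertex-↑ˡ {n} G u rewrite splitAt-↑ˡ n u (size (adj G)) = refl

isVertex-↑ʳ : ∀ {n} (G : Graph n) (k : Edge G) → isVertex G (n ↑ʳ k) ≡ false
isVertex-↑ʳ {n} G k rewrite splitAt-↑ʳ n (size (adj G)) k = refl

SSumAdj'-disjoint : ∀ {n m} (G : Graph n) (H : Graph m) x v a b →
  (isVertex G x ∧ ⌊ x ≟ a ⌋ ∧ adj H v b) ∧ (⌊ v ≟ b ⌋ ∧ subdivAdj G x a) ≡ false
SSumAdj'-disjoint G H x v a b with x ≟ a
... | yes refl rewrite subdivAdj-irrefl G x | ∧-zeroʳ ⌊ v ≟ b ⌋ = ∧-zeroʳ _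
... | no  _    rewrite ∧-zeroʳ (isVertex G x) = refl

b2n-SSumAdj' : ∀ {n m} (G : Graph n) (H : Graph m) x v a b →
  b2n (SSumAdj' G H (x , v) (a , b))
    ≡ b2n ⌊ x ≟ a ⌋ * (b2n (isVertex G x) * b2n (adj H v b)) + b2n ⌊ v ≟ b ⌋ * b2n (subdivAdj G x a)
b2n-SSumAdj' G H x v a b = begin
  b2n ((isVertex G x ∧ ⌊ x ≟ a ⌋ ∧ adj H v b) ∨ (⌊ v ≟ b ⌋ ∧ subdivAdj G x a))
    ≡⟨ b2n-∨-disjoint (isVertex G x ∧ ⌊ x ≟ a ⌋ ∧ adj H v b) (⌊ v ≟ b ⌋ ∧ subdivAdj G x a)
                      (SSumAdj'-disjoint G H x v a b) ⟩
  b2n (isVertex G x ∧ ⌊ x ≟ a ⌋ ∧ adj H v b) + b2n (⌊ v ≟ b ⌋ ∧ subdivAdj G x a)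
    ≡⟨ cong₂ _+_ (trans (b2n-∧ (isVertex G x) _) (cong (b2n (isVertex G x) *_) (b2n-∧ ⌊ x ≟ a ⌋ _)))
                 (b2n-∧ ⌊ v ≟ b ⌋ _) ⟩
  b2n (isVertex G x) * (b2n ⌊ x ≟ a ⌋ * b2n (adj H v b)) + b2n ⌊ v ≟ b ⌋ * b2n (subdivAdj G x a)
    ≡⟨ cong (_+ b2n ⌊ v ≟ b ⌋ * b2n (subdivAdj G x a))
            (x∙yz≈y∙xz *-commutativeSemigroup (b2n (isVertex G x)) (b2n ⌊ x ≟ a ⌋) (b2n (adj H v b))) ⟩
  b2n ⌊ x ≟ a ⌋ * (b2n (isVertex G x) * b2n (adj H v b)) + b2n ⌊ v ≟ b ⌋ * b2n (subdivAdj G x a) ∎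

deg-SSum : ∀ {n m} (G : Graph n) (H : Graph m) x v →
  deg (SSum G H) (combine x v) ≡ b2n (isVertex G x) * deg (adj H) v + deg (subdivAdj G) x
deg-SSum {n} {m} G H x v = begin
  deg (SSum G H) (combine x v)
    ≡⟨ listSum-allFin (b2n ∘ SSum G H (combine x v)) ⟩
  ∑[ y < N * m ] b2n (SSumAdj' G H (remQuot m (combine x v)) (remQuot m y))
    ≡⟨ ∑-remQuot N m (b2n ∘ SSumAdj' G H (remQuot m (combine x v))) ⟩
  ∑[ a < N ] ∑[ b < m ] b2n (SSumAdj' G H (remQuot m (combine x v)) (a , b))
    ≡⟨ cong (λ p → ∑[ a < N ] ∑[ b < m ] b2n (SSumAdj' G H p (a , b))) (remQuot-combine x v) ⟩
  ∑[ a < N ] ∑[ b < m ] b2n (SSumAdj' G H (x , v) (a , b))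
    ≡⟨ sum-cong-≗ (λ a → sum-cong-≗ (b2n-SSumAdj' G H x v a)) ⟩
  ∑[ a < N ] ∑[ b < m ] (b2n ⌊ x ≟ a ⌋ * fibre b + b2n ⌊ v ≟ b ⌋ * layer a)
    ≡⟨ ∑∑-distrib-+ (λ a b → b2n ⌊ x ≟ a ⌋ * fibre b) (λ a b → b2n ⌊ v ≟ b ⌋ * layer a) ⟩
  ∑[ a < N ] ∑[ b < m ] (b2n ⌊ x ≟ a ⌋ * fibre b) + ∑[ a < N ] ∑[ b < m ] (b2n ⌊ v ≟ b ⌋ * layer a)
    ≡⟨ cong₂ _+_ (trans (∑-comm (λ a b → b2n ⌊ x ≟ a ⌋ * fibre b))
                        (sum-cong-≗ (λ b → ∑-δ x (λ _ → fibre b))))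
                 (sum-cong-≗ (λ a → ∑-δ v (λ _ → layer a))) ⟩
  ∑[ b < m ] fibre b + ∑[ a < N ] layer a
    ≡⟨ cong₂ _+_ (sym (*-distribˡ-sum (b2n (isVertex G x)) (b2n ∘ adj H v))) (sym (listSum-allFin layer)) ⟩
  b2n (isVertex G x) * ∑[ b < m ] b2n (adj H v b) + deg (subdivAdj G) x
    ≡⟨ cong (λ d → b2n (isVertex G x) * d + deg (subdivAdj G) x) (sym (listSum-allFin (b2n ∘ adj H v))) ⟩
  b2n (isVertex G x) * deg (adj H) v + deg (subdivAdj G) x ∎
  where
  N = n + size (adj G)
  fibre : Fin m → ℕ
  fibre b = b2n (isVertex G x) * b2n (adj H v b)
  layer : Fin N → ℕ
  layer a = b2n (subdivAdj G x a)

deg-SSum-vertex : ∀ {n m} (G : Graph n) (H : Graph m) u v →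
  deg (SSum G H) (combine (u ↑ˡ size (adj G)) v) ≡ deg (adj G) u + deg (adj H) v
deg-SSum-vertex G H u v = begin
  deg (SSum G H) (combine (u ↑ˡ size (adj G)) v)
    ≡⟨ deg-SSum G H (u ↑ˡ size (adj G)) v ⟩
  b2n (isVertex G (u ↑ˡ size (adj G))) * deg (adj H) v + deg (subdivAdj G) (u ↑ˡ size (adj G))
    ≡⟨ cong₂ (λ t d → b2n t * deg (adj H) v + d) (isVertex-↑ˡ G u) (deg-subdivAdj-vertex G u) ⟩
  1 * deg (adj H) v + deg (adj G) u
    ≡⟨ cong (_+ deg (adj G) u) (*-identityˡ (deg (adj H) v)) ⟩
  deg (adj H) v + deg (adj G) u
    ≡⟨ +-comm (deg (adj H) v) (deg (adj G) u) ⟩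
  deg (adj G) u + deg (adj H) v ∎

deg-SSum-edge : ∀ {n m} (G : Graph n) (H : Graph m) k v → deg (SSum G H) (combine (n ↑ʳ k) v) ≡ 2
deg-SSum-edge {n} G H k v = begin
  deg (SSum G H) (combine (n ↑ʳ k) v)
    ≡⟨ deg-SSum G H (n ↑ʳ k) v ⟩
  b2n (isVertex G (n ↑ʳ k)) * deg (adj H) v + deg (subdivAdj G) (n ↑ʳ k)
    ≡⟨ cong₂ (λ t d → b2n t * deg (adj H) v + d) (isVertex-↑ʳ G k) (deg-subdivAdj-edge G k) ⟩
  2 ∎

Fidx-SSum : ∀ {n m} (G : Graph n) (H : Graph m) →
  Fidx (SSum G H) ≡ ∑[ u < n ] ∑[ v < m ] ((deg (adj G) u + deg (adj H) v) ^ 3) + size (adj G) * (m * 8)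
Fidx-SSum {n} {m} G H = begin
  Fidx (SSum G H)
    ≡⟨ listSum-allFin (λ x → d x ^ 3) ⟩
  ∑[ x < (n + s) * m ] (d x ^ 3)
    ≡⟨ ∑-combine (n + s) (λ x → d x ^ 3) ⟩
  ∑[ x < n + s ] ∑[ v < m ] (d (combine x v) ^ 3)
    ≡⟨ ∑-↑ n (λ x → ∑[ v < m ] (d (combine x v) ^ 3)) ⟩
  ∑[ u < n ] ∑[ v < m ] (d (combine (u ↑ˡ s) v) ^ 3) + ∑[ k < s ] ∑[ v < m ] (d (combine (n ↑ʳ k) v) ^ 3)
    ≡⟨ cong₂ _+_ (sum-cong-≗ (λ u → sum-cong-≗ (λ v → cong (_^ 3) (deg-SSum-vertex G H u v))))
                 (sum-cong-≗ (λ k → sum-cong-≗ (λ v → cong (_^ 3) (deg-SSum-edge G H k v)))) ⟩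
  ∑[ u < n ] ∑[ v < m ] ((deg (adj G) u + deg (adj H) v) ^ 3) + ∑[ k < s ] ∑[ v < m ] 8
    ≡⟨ cong (∑[ u < n ] ∑[ v < m ] ((deg (adj G) u + deg (adj H) v) ^ 3) +_)
            (trans (sum-cong-≗ {s} (λ _ → ∑-const m 8)) (∑-const s (m * 8))) ⟩
  ∑[ u < n ] ∑[ v < m ] ((deg (adj G) u + deg (adj H) v) ^ 3) + s * (m * 8) ∎
  where
  s = size (adj G)
  d = deg (SSum G H)

cube-+ : ∀ x y → (x + y) ^ 3 ≡ x ^ 3 * 1 + 1 * y ^ 3 + 3 * x ^ 2 * y + 3 * x * y ^ 2
cube-+ = expanded
  where
  -- the ring solver needs the powers unfolded
  expanded : ∀ x y → (x + y) * ((x + y) * ((x + y) * 1))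
    ≡ x * (x * (x * 1)) * 1 + 1 * (y * (y * (y * 1))) + 3 * (x * (x * 1)) * y + 3 * x * (y * (y * 1))
  expanded = solve-∀

∑∑-cube-+ : ∀ {n m} (f : Fin n → ℕ) (g : Fin m → ℕ) →
  ∑[ i < n ] ∑[ j < m ] ((f i + g j) ^ 3)
    ≡ ∑[ i < n ] (f i ^ 3) * m + n * ∑[ j < m ] (g j ^ 3)
      + 3 * ∑[ i < n ] (f i ^ 2) * ∑[ j < m ] g j + 3 * ∑[ i < n ] f i * ∑[ j < m ] (g j ^ 2)
∑∑-cube-+ {n} {m} f g = begin
  ∑[ i < n ] ∑[ j < m ] ((f i + g j) ^ 3)
    ≡⟨ sum-cong-≗ (λ i → sum-cong-≗ (λ j → cube-+ (f i) (g j))) ⟩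
  ∑[ i < n ] ∑[ j < m ] (t₁ i j + t₂ i j + t₃ i j + t₄ i j)
    ≡⟨ ∑∑-distrib-+ (λ i j → t₁ i j + t₂ i j + t₃ i j) t₄ ⟩
  ∑∑ (λ i j → t₁ i j + t₂ i j + t₃ i j) + ∑∑ t₄
    ≡⟨ cong (_+ ∑∑ t₄) (∑∑-distrib-+ (λ i j → t₁ i j + t₂ i j) t₃) ⟩
  ∑∑ (λ i j → t₁ i j + t₂ i j) + ∑∑ t₃ + ∑∑ t₄
    ≡⟨ cong (λ z → z + ∑∑ t₃ + ∑∑ t₄) (∑∑-distrib-+ t₁ t₂) ⟩
  ∑∑ t₁ + ∑∑ t₂ + ∑∑ t₃ + ∑∑ t₄
    ≡⟨ cong₂ _+_ (cong₂ _+_ (cong₂ _+_ ∑∑t₁ ∑∑t₂) ∑∑t₃) ∑∑t₄ ⟩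
  ∑[ i < n ] (f i ^ 3) * m + n * ∑[ j < m ] (g j ^ 3)
    + 3 * ∑[ i < n ] (f i ^ 2) * ∑[ j < m ] g j + 3 * ∑[ i < n ] f i * ∑[ j < m ] (g j ^ 2) ∎
  where
  ∑-one : ∀ k → ∑[ _ < k ] 1 ≡ k
  ∑-one k = trans (∑-const k 1) (*-identityʳ k)
  ∑∑ : (Fin n → Fin m → ℕ) → ℕ
  ∑∑ t = ∑[ i < n ] ∑[ j < m ] t i j
  t₁ t₂ t₃ t₄ : Fin n → Fin m → ℕ
  t₁ i j = f i ^ 3 * 1
  t₂ i j = 1 * g j ^ 3
  t₃ i j = 3 * f i ^ 2 * g j
  t₄ i j = 3 * f i * g j ^ 2
  ∑∑t₁ : ∑∑ t₁ ≡ ∑[ i < n ] (f i ^ 3) * m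
  ∑∑t₁ = trans (∑∑-* {m = m} (λ i → f i ^ 3) (λ _ → 1)) (cong (∑[ i < n ] (f i ^ 3) *_) (∑-one m))
  ∑∑t₂ : ∑∑ t₂ ≡ n * ∑[ j < m ] (g j ^ 3)
  ∑∑t₂ = trans (∑∑-* {n} (λ _ → 1) (λ j → g j ^ 3)) (cong (_* ∑[ j < m ] (g j ^ 3)) (∑-one n))
  ∑∑t₃ : ∑∑ t₃ ≡ 3 * ∑[ i < n ] (f i ^ 2) * ∑[ j < m ] g j
  ∑∑t₃ = trans (∑∑-* (λ i → 3 * f i ^ 2) g)
               (cong (_* ∑[ j < m ] g j) (sym (*-distribˡ-sum 3 (λ i → f i ^ 2))))
  ∑∑t₄ : ∑∑ t₄ ≡ 3 * ∑[ i < n ] f i * ∑[ j < m ] (g j ^ 2)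
  ∑∑t₄ = trans (∑∑-* (λ i → 3 * f i) (λ j → g j ^ 2))
               (cong (_* ∑[ j < m ] (g j ^ 2)) (sym (*-distribˡ-sum 3 f)))

∑∑-deg-cube : ∀ {n m} (G : Graph n) (H : Graph m) →
  ∑[ u < n ] ∑[ v < m ] ((deg (adj G) u + deg (adj H) v) ^ 3)
    ≡ Fidx (adj G) * m + n * Fidx (adj H)
      + 3 * M1 (adj G) * (size (adj H) * 2) + 3 * (size (adj G) * 2) * M1 (adj H)
∑∑-deg-cube {n} {m} G H = begin
  ∑[ u < n ] ∑[ v < m ] ((dG u + dH v) ^ 3)
    ≡⟨ ∑∑-cube-+ dG dH ⟩
  ∑[ u < n ] (dG u ^ 3) * m + n * ∑[ v < m ] (dH v ^ 3)
    + 3 * ∑[ u < n ] (dG u ^ 2) * ∑[ v < m ] dH v + 3 * ∑[ u < n ] dG u * ∑[ v < m ] (dH v ^ 2)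
    ≡⟨ cong₂ _+_ (cong₂ _+_ (cong₂ _+_
         (cong (_* m) (sym (listSum-allFin (λ u → dG u ^ 3))))
         (cong (n *_) (sym (listSum-allFin (λ v → dH v ^ 3)))))
         (cong₂ (λ a b → 3 * a * b) (sym (listSum-allFin (λ u → dG u ^ 2))) (handshake H)))
         (cong₂ (λ a b → 3 * a * b) (handshake G) (sym (listSum-allFin (λ v → dH v ^ 2)))) ⟩
  Fidx (adj G) * m + n * Fidx (adj H)
    + 3 * M1 (adj G) * (size (adj H) * 2) + 3 * (size (adj G) * 2) * M1 (adj H) ∎
  where
  dG = deg (adj G)
  dH = deg (adj H)

theorem2 : ∀ {n m} (G : Graph n) (H : Graph m) →
    2 ≤ n → Connected G → Connected H →
    Fidx (SSum G H) ≡
      m * Fidx (adj G) + n * Fidx (adj H) + 6 * size (adj H) * M1 (adj G)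
        + 6 * size (adj G) * M1 (adj H) + 8 * m * size (adj G)
theorem2 {n} {m} G H _ _ _ = begin
  Fidx (SSum G H)
    ≡⟨ Fidx-SSum G H ⟩
  ∑[ u < n ] ∑[ v < m ] ((deg (adj G) u + deg (adj H) v) ^ 3) + sG * (m * 8)
    ≡⟨ cong (_+ sG * (m * 8)) (∑∑-deg-cube G H) ⟩
  FG * m + n * FH + 3 * MG * (sH * 2) + 3 * (sG * 2) * MH + sG * (m * 8)
    ≡⟨ collect m n FG FH MG MH sG sH ⟩
  m * FG + n * FH + 6 * sH * MG + 6 * sG * MH + 8 * m * sG ∎
  where
  FG = Fidx (adj G)
  FH = Fidx (adj H)
  MG = M1 (adj G)
  MH = M1 (adj H)
  sG = size (adj G)
  sH = size (adj H)
  collect : ∀ m n FG FH MG MH sG sH →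
    FG * m + n * FH + 3 * MG * (sH * 2) + 3 * (sG * 2) * MH + sG * (m * 8)
      ≡ m * FG + n * FH + 6 * sH * MG + 6 * sG * MH + 8 * m * sG
  collect = solve-∀
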